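{- For every $u\in\mathbb{Z}\langle{\bf a},{\bf b}\rangle$, writing $\Delta(u)=\sum_j v_j\otimes w_j$, we have $$u=\kappa(u)+\sum_j\kappa(v_j)\cdot{\bf b}\cdot w_j\qquad\text{and}\qquad u=\lambda(u)+\sum_j\lambda(v_j)\cdot{\bf a}\cdot w_j.$$
   Context: ${\bf a},{\bf b}$ are non-commuting variables; $\mathbb{Z}\langle{\bf a},{\bf b}\rangle$ is the non-commutative polynomial ring. The coproduct $\Delta$ is the linear map with $\Delta(u_1u_2\cdots u_n)=\sum_{i=1}^nu_1\cdots u_{i-1}\otimes u_{i+1}\cdots u_n$ for monomials ($u_i\in\{{\bf a},{\bf b}\}$), so $\Delta(1)=0$. $\kappa$ and $\lambda$ are the ring homomorphisms $\mathbb{Z}\langle{\bf a},{\bf b}\rangle\to\mathbb{Z}\langle{\bf a},{\bf b}\rangle$ with $\kappa({\bf a})={\bf a}-{\bf b}$, $\kappa({\bf b})=0$, $\kappa(1)=1$, and $\lambda({\bf a})=0$, $\lambda({\bf b})={\bf b}-{\bf a}$, $\lambda(1)=1$. -}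

module Defs where

open import Data.Integer using (ℤ; +_; -_; _*_; _+_)
open import Data.List using (List; []; _∷_; _++_; concatMap; map)
open import Data.List.Properties using (≡-dec)
open import Data.Product using (_×_; _,_)
open import Relation.Binary.PropositionalEquality using (_≡_; refl)
open import Relation.Nullary using (yes; no)
open import Relation.Binary.Definitions using (DecidableEquality)

data Letter : Set where
  𝐚 𝐛 : Letter

_≟L_ : DecidableEquality Letter
𝐚 ≟L 𝐚 = yes refl
𝐚 ≟L 𝐛 = no λ ()
𝐛 ≟L 𝐚 = no λ ()
𝐛 ≟L 𝐛 = yes refl

Word : Set
Word = List Letter

_≟W_ : DecidableEquality Word
_≟W_ = ≡-dec _≟L_

-- An element of ℤ⟨a,b⟩, represented as a formal finite sum  Σ cᵢ wᵢ
Poly : Set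
Poly = List (ℤ × Word)

Tensor : Set
Tensor = List (ℤ × Word × Word)

coeff : Poly → Word → ℤ
coeff [] w = + 0
coeff ((c , v) ∷ p) w with v ≟W w
... | yes _ = c + coeff p w
... | no  _ = coeff p w

-- equality in ℤ⟨a,b⟩: all coefficients agree
infix 4 _≈_
_≈_ : Poly → Poly → Set
p ≈ q = ∀ w → coeff p w ≡ coeff q w

infixl 6 _⊕_
_⊕_ : Poly → Poly → Poly
p ⊕ q = p ++ q

scale : ℤ → Poly → Poly
scale c = map (λ { (d , w) → (c * d , w) })

infixl 7 _⊛_
_⊛_ : Poly → Poly → Poly
p ⊛ q = concatMap (λ { (c , v) → map (λ { (d , w) → (c * d , v ++ w) }) q }) p

mono : Word → Poly
mono w = (+ 1 , w) ∷ []

linext : (Word → Poly) → Poly → Poly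
linext f = concatMap (λ { (c , w) → scale c (f w) })

homext : (Letter → Poly) → Word → Poly
homext g [] = mono []
homext g (x ∷ w) = g x ⊛ homext g w

κ-gen : Letter → Poly
κ-gen 𝐚 = (+ 1 , 𝐚 ∷ []) ∷ (- (+ 1) , 𝐛 ∷ []) ∷ []
κ-gen 𝐛 = []

λ-gen : Letter → Poly
λ-gen 𝐚 = []
λ-gen 𝐛 = (+ 1 , 𝐛 ∷ []) ∷ (- (+ 1) , 𝐚 ∷ []) ∷ []

κ : Poly → Poly
κ = linext (homext κ-gen)

λ' : Poly → Poly
λ' = linext (homext λ-gen)

-- coproduct on monomials: Δ(u₁⋯uₙ) = Σᵢ u₁⋯uᵢ₋₁ ⊗ uᵢ₊₁⋯uₙ
Δw : Word → Tensor
Δw [] = []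
Δw (x ∷ w) = (+ 1 , [] , w) ∷ map (λ { (c , v , v') → (c , x ∷ v , v') }) (Δw w)

Δ : Poly → Tensor
Δ = concatMap (λ { (c , w) → map (λ { (d , v , v') → (c * d , v , v') }) (Δw w) })

sumT : (Word → Word → Poly) → Tensor → Poly
sumT f = concatMap (λ { (c , v , w) → scale c (f v w) })

module Submission where

-- Let g be a map from letters to polynomials and ℓ a letter
-- such that every letter y satisfies  y = g(y) + ℓ  (for κ: g = κ on generators,
-- ℓ = b, since a = (a − b) + b and b = 0 + b; for λ symmetrically with ℓ = a).
-- Write H for the ring homomorphism extending g.  Then for every word y·x
--   y·x = g(y)·x + ℓ·x ,
-- and induction on the word gives  x = H(x) + Σⱼ H(vⱼ)·ℓ·wⱼ  over Δ(x) = Σⱼ vⱼ ⊗ wⱼ,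
-- because Δ(y·x) = 1 ⊗ x + (y ⊗ 1)·Δ(x), so the correction term of y·x is
-- ℓ·x + g(y)·(correction term of x).  Both sides are linear in x, so the
-- identity extends from words to all polynomials.

open import Defs
open import Algebra.Bundles using (CommutativeSemigroup)
open import Data.Integer using (ℤ; +_; -_; _*_; _+_)
open import Data.Integer.Properties as ℤ using ()
open import Data.List using ([]; _∷_; _++_; map)
open import Data.List.Properties
  using (map-cong; map-∘; map-++; map-id; ++-assoc; ++-identityʳ; ∷-injectiveʳ; concatMap-++)
open import Data.Product using (_×_; _,_)
open import Function using (_∘_)
open import Relation.Binary.Bundles using (Setoid)
open import Relation.Binary.Structures using (IsEquivalence)
open import Relation.Binary.PropositionalEquality
  using (_≡_; _≢_; refl; sym; trans; cong; cong₂; module ≡-Reasoning)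
open import Relation.Nullary using (yes; no; Dec; contradiction)
import Relation.Binary.Reasoning.Setoid as SetoidReasoning
import Algebra.Properties.CommutativeSemigroup ℤ.*-commutativeSemigroup as ℤ*

coeff-hit : ∀ c v p w → v ≡ w → coeff ((c , v) ∷ p) w ≡ c + coeff p w
coeff-hit c v p w v≡w with v ≟W w
... | yes _   = refl
... | no v≢w = contradiction v≡w v≢w

coeff-miss : ∀ c v p w → v ≢ w → coeff ((c , v) ∷ p) w ≡ coeff p w
coeff-miss c v p w v≢w with v ≟W w
... | yes v≡w = contradiction v≡w v≢w
... | no _    = refl

coeff-⊕ : ∀ p q w → coeff (p ⊕ q) w ≡ coeff p w + coeff q w
coeff-⊕ []            q w = sym (ℤ.+-identityˡ _)
coeff-⊕ ((c , v) ∷ p) q w with v ≟W w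
... | yes _ = trans (cong (_+_ c) (coeff-⊕ p q w)) (sym (ℤ.+-assoc c _ _))
... | no _  = coeff-⊕ p q w

coeff-scale : ∀ c p w → coeff (scale c p) w ≡ c * coeff p w
coeff-scale c []            w = sym (ℤ.*-zeroʳ c)
coeff-scale c ((d , v) ∷ p) w with v ≟W w
... | yes _ = trans (cong (_+_ (c * d)) (coeff-scale c p w)) (sym (ℤ.*-distribˡ-+ c d _))
... | no _  = coeff-scale c p w

≈-isEquivalence : IsEquivalence _≈_
≈-isEquivalence = record
  { refl  = λ _ → refl
  ; sym   = λ p≈q w → sym (p≈q w)
  ; trans = λ p≈q q≈r w → trans (p≈q w) (q≈r w)
  }

≈-setoid : Setoid _ _
≈-setoid = record { isEquivalence = ≈-isEquivalence }

open Setoid ≈-setoid using () renaming (refl to ≈-refl; reflexive to ≡⇒≈)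
module ≈-Reasoning = SetoidReasoning ≈-setoid

⊕-cong : ∀ {p p′ q q′} → p ≈ p′ → q ≈ q′ → p ⊕ q ≈ p′ ⊕ q′
⊕-cong {p} {p′} {q} {q′} p≈p′ q≈q′ w = begin
  coeff (p ⊕ q) w          ≡⟨ coeff-⊕ p q w ⟩
  coeff p w + coeff q w    ≡⟨ cong₂ _+_ (p≈p′ w) (q≈q′ w) ⟩
  coeff p′ w + coeff q′ w  ≡⟨ coeff-⊕ p′ q′ w ⟨
  coeff (p′ ⊕ q′) w        ∎
  where open ≡-Reasoning

-- Congruence in one summand; the fixed polynomials are explicit because they
-- cannot be inferred from a pointwise equality of coefficients.
⊕-congˡ : ∀ p q q′ → q ≈ q′ → p ⊕ q ≈ p ⊕ q′
⊕-congˡ p q q′ = ⊕-cong {p} {p} {q} {q′} (λ _ → refl)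

⊕-congʳ : ∀ p p′ q → p ≈ p′ → p ⊕ q ≈ p′ ⊕ q
⊕-congʳ p p′ q p≈p′ = ⊕-cong {p} {p′} {q} {q} p≈p′ (λ _ → refl)

⊕-comm : ∀ p q → p ⊕ q ≈ q ⊕ p
⊕-comm p q w = begin
  coeff (p ⊕ q) w        ≡⟨ coeff-⊕ p q w ⟩
  coeff p w + coeff q w  ≡⟨ ℤ.+-comm (coeff p w) _ ⟩
  coeff q w + coeff p w  ≡⟨ coeff-⊕ q p w ⟨
  coeff (q ⊕ p) w        ∎
  where open ≡-Reasoning

-- The structure that gives access to the library's rearrangement lemmas.
⊕-commutativeSemigroup : CommutativeSemigroup _ _
⊕-commutativeSemigroup = record
  { Carrier                = Poly
  ; _≈_                    = _≈_
  ; _∙_                    = _⊕_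
  ; isCommutativeSemigroup = record
    { isSemigroup = record
      { isMagma = record
        { isEquivalence = ≈-isEquivalence
        ; ∙-cong        = λ {p p′ q q′} → ⊕-cong {p} {p′} {q} {q′}
        }
      ; assoc   = λ p q r → ≡⇒≈ (++-assoc p q r)
      }
    ; comm        = ⊕-comm
    }
  }

open import Algebra.Properties.CommutativeSemigroup ⊕-commutativeSemigroup
  using (interchange; xy∙z≈x∙zy)

cancelling-pair : ∀ c v p → p ≈ (- c , v) ∷ (c , v) ∷ p
cancelling-pair c v p w = sym (cancel (v ≟W w))
  where
  cancel : Dec (v ≡ w) → coeff ((- c , v) ∷ (c , v) ∷ p) w ≡ coeff p w
  cancel (yes v≡w) = begin
    coeff ((- c , v) ∷ (c , v) ∷ p) w  ≡⟨ coeff-hit (- c) v ((c , v) ∷ p) w v≡w ⟩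
    - c + coeff ((c , v) ∷ p) w        ≡⟨ cong (_+_ (- c)) (coeff-hit c v p w v≡w) ⟩
    - c + (c + coeff p w)              ≡⟨ ℤ.+-assoc (- c) c _ ⟨
    (- c + c) + coeff p w              ≡⟨ cong (_+ coeff p w) (ℤ.+-inverseˡ c) ⟩
    + 0 + coeff p w                    ≡⟨ ℤ.+-identityˡ _ ⟩
    coeff p w                          ∎
    where open ≡-Reasoning
  cancel (no v≢w) = trans (coeff-miss (- c) v ((c , v) ∷ p) w v≢w) (coeff-miss c v p w v≢w)

scale-cong : ∀ c {p q} → p ≈ q → scale c p ≈ scale c q
scale-cong c {p} {q} p≈q w = begin
  coeff (scale c p) w  ≡⟨ coeff-scale c p w ⟩
  c * coeff p w        ≡⟨ cong (c *_) (p≈q w) ⟩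
  c * coeff q w        ≡⟨ coeff-scale c q w ⟨
  coeff (scale c q) w  ∎
  where open ≡-Reasoning

scale-one : ∀ p → scale (+ 1) p ≡ p
scale-one []            = refl
scale-one ((d , v) ∷ p) = cong₂ _∷_ (cong (_, v) (ℤ.*-identityˡ d)) (scale-one p)

scale-scale : ∀ c d p → scale (c * d) p ≡ scale c (scale d p)
scale-scale c d p = trans (map-cong (λ { (e , v) → cong (_, v) (ℤ.*-assoc c d e) }) p) (map-∘ p)

mul : ℤ → Word → ℤ × Word → ℤ × Word
mul c v (d , w) = (c * d , v ++ w)

⊛-cons : ∀ c v p q → ((c , v) ∷ p) ⊛ q ≡ map (mul c v) q ⊕ p ⊛ q
⊛-cons c v p q = cong (_⊕ p ⊛ q) (map-cong (λ _ → refl) q)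

mul-⊛ : ∀ c v q r → map (mul c v) q ⊛ r ≡ map (mul c v) (q ⊛ r)
mul-⊛ c v []            r = refl
mul-⊛ c v ((d , u) ∷ q) r = begin
  map (mul (c * d) (v ++ u)) r ⊕ map (mul c v) q ⊛ r
    ≡⟨ cong₂ _⊕_ (trans (map-cong mul-assoc r) (map-∘ r)) (mul-⊛ c v q r) ⟩
  map (mul c v) (map (mul d u) r) ⊕ map (mul c v) (q ⊛ r)
    ≡⟨ map-++ (mul c v) (map (mul d u) r) (q ⊛ r) ⟨
  map (mul c v) (map (mul d u) r ⊕ q ⊛ r)
    ≡⟨ cong (map (mul c v)) (⊛-cons d u q r) ⟨
  map (mul c v) (((d , u) ∷ q) ⊛ r)
    ∎
  where
  open ≡-Reasoning
  mul-assoc : ∀ t → mul (c * d) (v ++ u) t ≡ mul c v (mul d u t)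
  mul-assoc (e , w) = cong₂ _,_ (ℤ.*-assoc c d e) (++-assoc v u w)

⊛-assoc : ∀ p q r → (p ⊛ q) ⊛ r ≡ p ⊛ (q ⊛ r)
⊛-assoc []            q r = refl
⊛-assoc ((c , v) ∷ p) q r = begin
  (((c , v) ∷ p) ⊛ q) ⊛ r              ≡⟨ cong (_⊛ r) (⊛-cons c v p q) ⟩
  (map (mul c v) q ⊕ p ⊛ q) ⊛ r        ≡⟨ concatMap-++ _ (map (mul c v) q) (p ⊛ q) ⟩
  map (mul c v) q ⊛ r ⊕ (p ⊛ q) ⊛ r    ≡⟨ cong₂ _⊕_ (mul-⊛ c v q r) (⊛-assoc p q r) ⟩
  map (mul c v) (q ⊛ r) ⊕ p ⊛ (q ⊛ r)  ≡⟨ ⊛-cons c v p (q ⊛ r) ⟨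
  ((c , v) ∷ p) ⊛ (q ⊛ r)              ∎
  where open ≡-Reasoning

⊛-scale : ∀ c p q → scale c (p ⊛ q) ≡ p ⊛ scale c q
⊛-scale c []            q = refl
⊛-scale c ((d , v) ∷ p) q = begin
  scale c (((d , v) ∷ p) ⊛ q)                 ≡⟨ cong (scale c) (⊛-cons d v p q) ⟩
  scale c (map (mul d v) q ⊕ p ⊛ q)           ≡⟨ map-++ _ (map (mul d v) q) (p ⊛ q) ⟩
  scale c (map (mul d v) q) ⊕ scale c (p ⊛ q) ≡⟨ cong₂ _⊕_ scale-mul (⊛-scale c p q) ⟩
  map (mul d v) (scale c q) ⊕ p ⊛ scale c q   ≡⟨ ⊛-cons d v p (scale c q) ⟨
  ((d , v) ∷ p) ⊛ scale c q                   ∎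
  where
  open ≡-Reasoning
  scale-mul : scale c (map (mul d v) q) ≡ map (mul d v) (scale c q)
  scale-mul = trans (sym (map-∘ q))
    (trans (map-cong (λ { (e , w) → cong (_, v ++ w) (ℤ*.x∙yz≈y∙xz c d e) }) q) (map-∘ q))

⊛-[] : ∀ p → p ⊛ [] ≡ []
⊛-[] []            = refl
⊛-[] ((c , v) ∷ p) = ⊛-[] p

-- Left distributivity (right distributivity holds on the nose, by concatMap-++).
⊛-distribˡ : ∀ p q r → p ⊛ (q ⊕ r) ≈ p ⊛ q ⊕ p ⊛ r
⊛-distribˡ []            q r = ≈-refl {[]}
⊛-distribˡ ((c , v) ∷ p) q r = begin
  ((c , v) ∷ p) ⊛ (q ⊕ r)                         ≡⟨ ⊛-cons c v p (q ⊕ r) ⟩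
  map (mul c v) (q ⊕ r) ⊕ p ⊛ (q ⊕ r)             ≡⟨ cong (_⊕ p ⊛ (q ⊕ r)) (map-++ (mul c v) q r) ⟩
  (cvq ⊕ cvr) ⊕ p ⊛ (q ⊕ r)                       ≈⟨ ⊕-congˡ (cvq ⊕ cvr) _ _ (⊛-distribˡ p q r) ⟩
  (cvq ⊕ cvr) ⊕ (p ⊛ q ⊕ p ⊛ r)                   ≈⟨ interchange cvq cvr (p ⊛ q) (p ⊛ r) ⟩
  (cvq ⊕ p ⊛ q) ⊕ (cvr ⊕ p ⊛ r)                   ≡⟨ cong₂ _⊕_ (⊛-cons c v p q) (⊛-cons c v p r) ⟨
  ((c , v) ∷ p) ⊛ q ⊕ ((c , v) ∷ p) ⊛ r           ∎
  where
  open ≈-Reasoning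
  cvq = map (mul c v) q
  cvr = map (mul c v) r

shift : Word → ℤ × Word → ℤ × Word
shift v (d , w) = (d , v ++ w)

mul-as-shift : ∀ c v q → map (mul c v) q ≡ map (shift v) (scale c q)
mul-as-shift c v q = trans (map-cong (λ _ → refl) q) (map-∘ q)

coeff-shift-[] : ∀ l q → coeff (map (shift (l ∷ [])) q) [] ≡ + 0
coeff-shift-[] l []            = refl
coeff-shift-[] l ((d , u) ∷ q) =
  trans (coeff-miss d (l ∷ u) (map (shift (l ∷ [])) q) [] λ ()) (coeff-shift-[] l q)

coeff-shift-hit : ∀ l q w → coeff (map (shift (l ∷ [])) q) (l ∷ w) ≡ coeff q w
coeff-shift-hit l []            w = refl
coeff-shift-hit l ((d , u) ∷ q) w = by-cases (u ≟W w)
  where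
  by-cases : Dec (u ≡ w) →
             coeff (map (shift (l ∷ [])) ((d , u) ∷ q)) (l ∷ w) ≡ coeff ((d , u) ∷ q) w
  by-cases (yes u≡w) = trans (coeff-hit d (l ∷ u) _ (l ∷ w) (cong (l ∷_) u≡w))
    (trans (cong (_+_ d) (coeff-shift-hit l q w)) (sym (coeff-hit d u q w u≡w)))
  by-cases (no u≢w)  = trans (coeff-miss d (l ∷ u) _ (l ∷ w) (u≢w ∘ ∷-injectiveʳ))
    (trans (coeff-shift-hit l q w) (sym (coeff-miss d u q w u≢w)))

coeff-shift-miss : ∀ l l′ q w → l ≢ l′ → coeff (map (shift (l ∷ [])) q) (l′ ∷ w) ≡ + 0
coeff-shift-miss l l′ []            w l≢l′ = refl
coeff-shift-miss l l′ ((d , u) ∷ q) w l≢l′ =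
  trans (coeff-miss d (l ∷ u) _ (l′ ∷ w) λ { refl → l≢l′ refl }) (coeff-shift-miss l l′ q w l≢l′)

shift-letter-cong : ∀ l {q q′} → q ≈ q′ → map (shift (l ∷ [])) q ≈ map (shift (l ∷ [])) q′
shift-letter-cong l {q} {q′} q≈q′ [] = trans (coeff-shift-[] l q) (sym (coeff-shift-[] l q′))
shift-letter-cong l {q} {q′} q≈q′ (l′ ∷ w) with l ≟L l′
... | yes refl = trans (coeff-shift-hit l q w) (trans (q≈q′ w) (sym (coeff-shift-hit l q′ w)))
... | no l≢l′  = trans (coeff-shift-miss l l′ q w l≢l′) (sym (coeff-shift-miss l l′ q′ w l≢l′))

shift-cong : ∀ v {q q′} → q ≈ q′ → map (shift v) q ≈ map (shift v) q′
shift-cong [] {q} {q′} q≈q′ = begin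
  map (shift []) q   ≡⟨ shift-[] q ⟩
  q                  ≈⟨ q≈q′ ⟩
  q′                 ≡⟨ shift-[] q′ ⟨
  map (shift []) q′  ∎
  where
  open ≈-Reasoning
  shift-[] : ∀ p → map (shift []) p ≡ p
  shift-[] p = trans (map-cong (λ _ → refl) p) (map-id p)
shift-cong (l ∷ v) {q} {q′} q≈q′ = begin
  map (shift (l ∷ v)) q                     ≡⟨ map-∘ q ⟩
  map (shift (l ∷ [])) (map (shift v) q)    ≈⟨ shift-letter-cong l {map (shift v) q} {map (shift v) q′}
                                                 (shift-cong v {q} {q′} q≈q′) ⟩
  map (shift (l ∷ [])) (map (shift v) q′)   ≡⟨ map-∘ q′ ⟨
  map (shift (l ∷ v)) q′                    ∎
  where open ≈-Reasoning

-- Left multiplication respects ≈: each term of p acts by scaling and prefixing.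
⊛-congˡ : ∀ p {q q′} → q ≈ q′ → p ⊛ q ≈ p ⊛ q′
⊛-congˡ []            q≈q′ = ≈-refl {[]}
⊛-congˡ ((c , v) ∷ p) {q} {q′} q≈q′ = begin
  ((c , v) ∷ p) ⊛ q
    ≡⟨ unfold q ⟩
  map (shift v) (scale c q) ⊕ p ⊛ q
    ≈⟨ ⊕-cong {map (shift v) (scale c q)} {map (shift v) (scale c q′)}
         (shift-cong v {scale c q} {scale c q′} (scale-cong c {q} {q′} q≈q′))
         (⊛-congˡ p {q} {q′} q≈q′) ⟩
  map (shift v) (scale c q′) ⊕ p ⊛ q′
    ≡⟨ unfold q′ ⟨
  ((c , v) ∷ p) ⊛ q′
    ∎
  where
  open ≈-Reasoning
  unfold : ∀ r → ((c , v) ∷ p) ⊛ r ≡ map (shift v) (scale c r) ⊕ p ⊛ r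
  unfold r = trans (⊛-cons c v p r) (cong (_⊕ p ⊛ r) (mul-as-shift c v r))

rescale : ℤ → ℤ × Word × Word → ℤ × Word × Word
rescale c (d , v , w) = (c * d , v , w)

Δ-cons : ∀ c x p → Δ ((c , x) ∷ p) ≡ map (rescale c) (Δw x) ++ Δ p
Δ-cons c x p = cong (_++ Δ p) (map-cong (λ _ → refl) (Δw x))

prefixˡ : Letter → ℤ × Word × Word → ℤ × Word × Word
prefixˡ y (c , v , w) = (c , y ∷ v , w)

Δw-cons : ∀ y x → Δw (y ∷ x) ≡ (+ 1 , [] , x) ∷ map (prefixˡ y) (Δw x)
Δw-cons y x = cong ((+ 1 , [] , x) ∷_) (map-cong (λ _ → refl) (Δw x))

sumT-rescale : ∀ f c t → sumT f (map (rescale c) t) ≡ scale c (sumT f t)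
sumT-rescale f c []              = refl
sumT-rescale f c ((d , v , w) ∷ t) = begin
  scale (c * d) (f v w) ⊕ sumT f (map (rescale c) t)  ≡⟨ cong₂ _⊕_ (scale-scale c d (f v w)) (sumT-rescale f c t) ⟩
  scale c (scale d (f v w)) ⊕ scale c (sumT f t)      ≡⟨ map-++ _ (scale d (f v w)) (sumT f t) ⟨
  scale c (scale d (f v w) ⊕ sumT f t)                ∎
  where open ≡-Reasoning

module Expansion (g : Letter → Poly) (ℓ : Letter)
  (split : ∀ y x → mono (y ∷ x) ≈ g y ⊛ mono x ⊕ mono (ℓ ∷ x)) where

  H : Word → Poly
  H = homext g

  φ : Poly → Poly
  φ = linext H

  F : Word → Word → Poly
  F v w = φ (mono v) ⊛ mono (ℓ ∷ []) ⊛ mono w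

  R : Word → Poly
  R x = sumT F (Δw x)

  φ-mono : ∀ v → φ (mono v) ≡ H v
  φ-mono v = trans (++-identityʳ (scale (+ 1) (H v))) (scale-one (H v))

  -- Since φ agrees with the homomorphism H on words, F(y·v, w) = g(y)·F(v, w).
  F-cons : ∀ y v w → F (y ∷ v) w ≡ g y ⊛ F v w
  F-cons y v w = begin
    φ (mono (y ∷ v)) ⊛ ℓ′ ⊛ mono w    ≡⟨ cong (λ h → h ⊛ ℓ′ ⊛ mono w) (φ-mono (y ∷ v)) ⟩
    g y ⊛ H v ⊛ ℓ′ ⊛ mono w           ≡⟨ cong (_⊛ mono w) (⊛-assoc (g y) (H v) ℓ′) ⟩
    g y ⊛ (H v ⊛ ℓ′) ⊛ mono w         ≡⟨ ⊛-assoc (g y) (H v ⊛ ℓ′) (mono w) ⟩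
    g y ⊛ (H v ⊛ ℓ′ ⊛ mono w)         ≡⟨ cong (λ h → g y ⊛ (h ⊛ ℓ′ ⊛ mono w)) (φ-mono v) ⟨
    g y ⊛ F v w                       ∎
    where
    open ≡-Reasoning
    ℓ′ = mono (ℓ ∷ [])

  sumT-prefixˡ : ∀ y t → sumT F (map (prefixˡ y) t) ≈ g y ⊛ sumT F t
  sumT-prefixˡ y []                = ≡⇒≈ (sym (⊛-[] (g y)))
  sumT-prefixˡ y ((c , v , w) ∷ t) = begin
    scale c (F (y ∷ v) w) ⊕ sumT F (map (prefixˡ y) t)
      ≡⟨ cong (_⊕ sumT F (map (prefixˡ y) t))
              (trans (cong (scale c) (F-cons y v w)) (⊛-scale c (g y) (F v w))) ⟩
    g y ⊛ scale c (F v w) ⊕ sumT F (map (prefixˡ y) t)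
      ≈⟨ ⊕-congˡ (g y ⊛ scale c (F v w)) _ _ (sumT-prefixˡ y t) ⟩
    g y ⊛ scale c (F v w) ⊕ g y ⊛ sumT F t
      ≈⟨ ⊛-distribˡ (g y) (scale c (F v w)) (sumT F t) ⟨
    g y ⊛ (scale c (F v w) ⊕ sumT F t)
      ∎
    where open ≈-Reasoning

  -- The recursion for the correction term, read off from Δ(y·x) = 1 ⊗ x + (y ⊗ 1)·Δ(x).
  R-cons : ∀ y x → R (y ∷ x) ≈ mono (ℓ ∷ x) ⊕ g y ⊛ R x
  R-cons y x = begin
    R (y ∷ x)                                        ≡⟨ cong (sumT F) (Δw-cons y x) ⟩
    mono (ℓ ∷ x) ⊕ sumT F (map (prefixˡ y) (Δw x))   ≈⟨ ⊕-congˡ (mono (ℓ ∷ x)) _ _ (sumT-prefixˡ y (Δw x)) ⟩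
    mono (ℓ ∷ x) ⊕ g y ⊛ R x                         ∎
    where open ≈-Reasoning

  word-expansion : ∀ x → mono x ≈ H x ⊕ R x
  word-expansion []      = ≈-refl {mono []}
  word-expansion (y ∷ x) = begin
    mono (y ∷ x)
      ≈⟨ split y x ⟩
    g y ⊛ mono x ⊕ ℓx
      ≈⟨ ⊕-congʳ (g y ⊛ mono x) (g y ⊛ (H x ⊕ R x)) ℓx
           (⊛-congˡ (g y) {mono x} {H x ⊕ R x} (word-expansion x)) ⟩
    g y ⊛ (H x ⊕ R x) ⊕ ℓx
      ≈⟨ ⊕-congʳ (g y ⊛ (H x ⊕ R x)) (g y ⊛ H x ⊕ g y ⊛ R x) ℓx (⊛-distribˡ (g y) (H x) (R x)) ⟩
    (g y ⊛ H x ⊕ g y ⊛ R x) ⊕ ℓx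
      ≈⟨ xy∙z≈x∙zy (g y ⊛ H x) (g y ⊛ R x) ℓx ⟩
    g y ⊛ H x ⊕ (ℓx ⊕ g y ⊛ R x)
      ≈⟨ ⊕-congˡ (g y ⊛ H x) _ _ (R-cons y x) ⟨
    H (y ∷ x) ⊕ R (y ∷ x)
      ∎
    where
    open ≈-Reasoning
    ℓx = mono (ℓ ∷ x)

  expansion : ∀ u → u ≈ φ u ⊕ sumT F (Δ u)
  expansion []            = ≈-refl {[]}
  expansion ((c , x) ∷ p) = begin
    (c , x) ∷ p
      ≡⟨ cong (λ d → (d , x) ∷ p) (ℤ.*-identityʳ c) ⟨
    scale c (mono x) ⊕ p
      ≈⟨ ⊕-cong {scale c (mono x)} {scale c (H x ⊕ R x)} {p} {φ p ⊕ sumT F (Δ p)}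
           (scale-cong c {mono x} {H x ⊕ R x} (word-expansion x)) (expansion p) ⟩
    scale c (H x ⊕ R x) ⊕ (φ p ⊕ sumT F (Δ p))
      ≡⟨ cong (_⊕ (φ p ⊕ sumT F (Δ p))) (map-++ _ (H x) (R x)) ⟩
    (scale c (H x) ⊕ scale c (R x)) ⊕ (φ p ⊕ sumT F (Δ p))
      ≈⟨ interchange (scale c (H x)) (scale c (R x)) (φ p) (sumT F (Δ p)) ⟩
    (scale c (H x) ⊕ φ p) ⊕ (scale c (R x) ⊕ sumT F (Δ p))
      ≡⟨ cong (φ ((c , x) ∷ p) ⊕_) Δ-term ⟨
    φ ((c , x) ∷ p) ⊕ sumT F (Δ ((c , x) ∷ p))
      ∎
    where
    open ≈-Reasoning
    Δ-term : sumT F (Δ ((c , x) ∷ p)) ≡ scale c (R x) ⊕ sumT F (Δ p)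
    Δ-term = trans (cong (sumT F) (Δ-cons c x p))
      (trans (concatMap-++ _ (map (rescale c) (Δw x)) (Δ p))
             (cong (_⊕ sumT F (Δ p)) (sumT-rescale F c (Δw x))))

κ-split : ∀ y x → mono (y ∷ x) ≈ κ-gen y ⊛ mono x ⊕ mono (𝐛 ∷ x)
κ-split 𝐚 x = ⊕-congˡ (mono (𝐚 ∷ x)) [] _ (cancelling-pair (+ 1) (𝐛 ∷ x) [])
κ-split 𝐛 x = ≈-refl {mono (𝐛 ∷ x)}

λ-split : ∀ y x → mono (y ∷ x) ≈ λ-gen y ⊛ mono x ⊕ mono (𝐚 ∷ x)
λ-split 𝐚 x = ≈-refl {mono (𝐚 ∷ x)}
λ-split 𝐛 x = ⊕-congˡ (mono (𝐛 ∷ x)) [] _ (cancelling-pair (+ 1) (𝐚 ∷ x) [])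

lemma4p2 : (u : Poly) →
    (u ≈ κ u ⊕ sumT (λ v w → κ (mono v) ⊛ mono (𝐛 ∷ []) ⊛ mono w) (Δ u))
    × (u ≈ λ' u ⊕ sumT (λ v w → λ' (mono v) ⊛ mono (𝐚 ∷ []) ⊛ mono w) (Δ u))
lemma4p2 u = Expansion.expansion κ-gen 𝐛 κ-split u , Expansion.expansion λ-gen 𝐚 λ-split u
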